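{- Let $p>3$ be a prime. Then \[ \prod_{k=1}^{p-1} (p+2k) \equiv (-1)^{\frac{p-1}{2}} \prod_{k=1}^{\frac{p-1}{2}} (2k-1)^2 \pmod{p^3}. \] -}

module Defs where

open import Data.Nat as ℕ using (ℕ; zero; suc)
open import Data.Integer using (ℤ; _*_; +_)

prod : ℕ → (ℕ → ℤ) → ℤ
prod zero    f = + 1
prod (suc n) f = prod n f * f (suc n)

{-# OPTIONS --safe #-}
-- Write p = 2n + 1.  Pairing k = n + 1 - j with k = n + j turns the left-hand product into
-- Πⱼ ((2p)² - (2j - 1)²).  Expanding in c = (2p)², it equals (-1)ⁿ Πⱼ (2j - 1)² + c·eₙ₋₁ + c²·r,
-- where eₙ₋₁ is the elementary symmetric polynomial of degree n - 1 in the xⱼ = -(2j - 1)²; as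
-- p² ∣ c it remains to show p ∣ eₙ₋₁.  Modulo p, eₙ₋₁ = Πⱼ xⱼ · Σⱼ xⱼ⁻¹, so it suffices that
-- Σⱼ (2j - 1)⁻² ≡ 0.  Write H, E, O for the sums of k⁻² over 1 ≤ k ≤ n, over even and over odd
-- k < p.  The reflection k ↦ p - k swaps odd and even k, so O ≡ E, and it shows
-- Σ_{k<p} k⁻² ≡ 2H; also H ≡ 4E.  Hence 8E ≡ 2H ≡ O + E ≡ 2E, and 6E ≡ 0 gives E ≡ O ≡ 0
-- because p > 3.
module Submission where

open import Defs
open import Data.Nat using (ℕ; _>_; _∸_; _/_)
open import Data.Nat.Primality using (Prime)
open import Data.Integer using (ℤ; +_; -_; _+_; _-_; _*_; _^_)
open import Data.Integer.Divisibility using (_∣_)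

open import Data.Nat as ℕ using (zero; suc; _≤_; _<_; z≤n; s≤s)
import Data.Nat.Properties as ℕ
import Data.Nat.Divisibility as ℕ
open import Data.Nat.DivMod using (m*n/n≡m)
open import Data.Nat.Coprimality using (Coprime; coprime?; coprime-Bézout; prime⇒coprime)
open import Data.Nat.GCD using (module Bézout)
open import Data.Nat.Primality using (composite⇒¬prime; composite-≢; prime⇒nonZero)
import Data.Nat.Tactic.RingSolver as NS
open import Data.Integer.Properties
open import Data.Integer.Coprimality using (coprime-divisor)
import Data.Integer.Divisibility.Signed as Signed
open Signed using (divides)
open import Data.Integer.Tactic.RingSolver using (solve-∀)
open import Data.Product using (∃-syntax; _,_)
open import Data.Sum using (_⊎_; inj₁; inj₂)
open import Relation.Binary.Bundles using (Setoid)
import Relation.Binary.Reasoning.Setoid as SetoidReasoning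
open import Relation.Binary.PropositionalEquality
open import Relation.Nullary using (yes; no; contradiction)

sum : ℕ → (ℕ → ℤ) → ℤ
sum zero    f = + 0
sum (suc n) f = sum n f + f (suc n)

prod-split : ∀ m n f → prod (m ℕ.+ n) f ≡ prod m f * prod n (λ j → f (m ℕ.+ j))
prod-split m zero    f rewrite ℕ.+-identityʳ m = sym (*-identityʳ (prod m f))
prod-split m (suc n) f rewrite ℕ.+-suc m n | prod-split m n f =
  *-assoc (prod m f) (prod n (λ j → f (m ℕ.+ j))) (f (suc (m ℕ.+ n)))

sum-split : ∀ m n f → sum (m ℕ.+ n) f ≡ sum m f + sum n (λ j → f (m ℕ.+ j))
sum-split m zero    f rewrite ℕ.+-identityʳ m = sym (+-identityʳ (sum m f))
sum-split m (suc n) f rewrite ℕ.+-suc m n | sum-split m n f =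
  +-assoc (sum m f) (sum n (λ j → f (m ℕ.+ j))) (f (suc (m ℕ.+ n)))

prod-shift : ∀ n f → prod (suc n) f ≡ f 1 * prod n (λ j → f (suc j))
prod-shift n f = trans (prod-split 1 n f) (cong (_* prod n (λ j → f (suc j))) (*-identityˡ (f 1)))

sum-shift : ∀ n f → sum (suc n) f ≡ f 1 + sum n (λ j → f (suc j))
sum-shift n f = trans (sum-split 1 n f) (cong (_+ sum n (λ j → f (suc j))) (+-identityˡ (f 1)))

prod-reverse : ∀ n f → prod n f ≡ prod n (λ j → f (suc n ∸ j))
prod-reverse zero    f = refl
prod-reverse (suc n) f = begin
  prod n f * f (suc n)                      ≡⟨ cong (_* f (suc n)) (prod-reverse n f) ⟩
  prod n (λ j → f (suc n ∸ j)) * f (suc n)  ≡⟨ *-comm _ (f (suc n)) ⟩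
  f (suc n) * prod n (λ j → f (suc n ∸ j))  ≡⟨ prod-shift n (λ j → f (suc (suc n) ∸ j)) ⟨
  prod (suc n) (λ j → f (suc (suc n) ∸ j))  ∎
  where open ≡-Reasoning

sum-reverse : ∀ n f → sum n f ≡ sum n (λ j → f (suc n ∸ j))
sum-reverse zero    f = refl
sum-reverse (suc n) f = begin
  sum n f + f (suc n)                      ≡⟨ cong (_+ f (suc n)) (sum-reverse n f) ⟩
  sum n (λ j → f (suc n ∸ j)) + f (suc n)  ≡⟨ +-comm _ (f (suc n)) ⟩
  f (suc n) + sum n (λ j → f (suc n ∸ j))  ≡⟨ sum-shift n (λ j → f (suc (suc n) ∸ j)) ⟨
  sum (suc n) (λ j → f (suc (suc n) ∸ j))  ∎
  where open ≡-Reasoning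

prod-* : ∀ n f g → prod n (λ j → f j * g j) ≡ prod n f * prod n g
prod-* zero    f g = refl
prod-* (suc n) f g rewrite prod-* n f g = lemma (prod n f) (prod n g) (f (suc n)) (g (suc n))
  where
  lemma : ∀ a b c d → a * b * (c * d) ≡ a * c * (b * d)
  lemma = solve-∀

sum-+ : ∀ n f g → sum n (λ j → f j + g j) ≡ sum n f + sum n g
sum-+ zero    f g = refl
sum-+ (suc n) f g rewrite sum-+ n f g = lemma (sum n f) (sum n g) (f (suc n)) (g (suc n))
  where
  lemma : ∀ a b c d → a + b + (c + d) ≡ a + c + (b + d)
  lemma = solve-∀

prod-cong : ∀ n {f g} → (∀ {j} → 1 ≤ j → j ≤ n → f j ≡ g j) → prod n f ≡ prod n g
prod-cong zero    f≡g = refl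
prod-cong (suc n) f≡g =
  cong₂ _*_ (prod-cong n (λ 1≤j j≤n → f≡g 1≤j (ℕ.m≤n⇒m≤1+n j≤n))) (f≡g (s≤s z≤n) ℕ.≤-refl)

prod-neg : ∀ n f → (- + 1) ^ n * prod n f ≡ prod n (λ j → - f j)
prod-neg zero    f = refl
prod-neg (suc n) f rewrite sym (prod-neg n f) = lemma ((- + 1) ^ n) (prod n f) (f (suc n))
  where
  lemma : ∀ s a b → (- + 1 * s) * (a * b) ≡ s * a * - b
  lemma = solve-∀

*-distribˡ-sum : ∀ n c f → c * sum n f ≡ sum n (λ j → c * f j)
*-distribˡ-sum zero    c f = *-zeroʳ c
*-distribˡ-sum (suc n) c f rewrite sym (*-distribˡ-sum n c f) = *-distribˡ-+ c (sum n f) (f (suc n))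

prod-halves : ∀ n f → prod (2 ℕ.* n) f ≡ prod n (λ j → f (suc n ∸ j) * f (n ℕ.+ j))
prod-halves n f = begin
  prod (2 ℕ.* n) f                                          ≡⟨ cong (λ m → prod (n ℕ.+ m) f) (ℕ.+-identityʳ n) ⟩
  prod (n ℕ.+ n) f                                          ≡⟨ prod-split n n f ⟩
  prod n f * prod n (λ j → f (n ℕ.+ j))                     ≡⟨ cong (_* prod n (λ j → f (n ℕ.+ j))) (prod-reverse n f) ⟩
  prod n (λ j → f (suc n ∸ j)) * prod n (λ j → f (n ℕ.+ j)) ≡⟨ prod-* n (λ j → f (suc n ∸ j)) (λ j → f (n ℕ.+ j)) ⟨
  prod n (λ j → f (suc n ∸ j) * f (n ℕ.+ j))                ∎
  where open ≡-Reasoning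

sum-pairs : ∀ n f → sum (2 ℕ.* n) f ≡ sum n (λ j → f (2 ℕ.* j ∸ 1) + f (2 ℕ.* j))
sum-pairs zero    f = refl
sum-pairs (suc n) f rewrite ℕ.+-suc n (n ℕ.+ 0) | sym (sum-pairs n f) =
  +-assoc (sum (2 ℕ.* n) f) (f (suc (2 ℕ.* n))) (f (suc (suc (2 ℕ.* n))))

infix 4 _≡_[mod_]
record _≡_[mod_] (a b m : ℤ) : Set where
  constructor congruence
  field m∣a-b : m Signed.∣ a - b

module _ {m : ℤ} where

  mod-reflexive : ∀ {a b} → a ≡ b → a ≡ b [mod m ]
  mod-reflexive {a} refl = congruence (divides (+ 0) (trans (+-inverseʳ a) (sym (*-zeroˡ m))))

  mod-sym : ∀ {a b} → a ≡ b [mod m ] → b ≡ a [mod m ]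
  mod-sym {a} {b} (congruence m∣a-b) = congruence (subst (m Signed.∣_) (lemma a b) (Signed.∣m⇒∣-m m∣a-b))
    where
    lemma : ∀ a b → - (a - b) ≡ b - a
    lemma = solve-∀

  mod-trans : ∀ {a b c} → a ≡ b [mod m ] → b ≡ c [mod m ] → a ≡ c [mod m ]
  mod-trans {a} {b} {c} (congruence m∣a-b) (congruence m∣b-c) =
    congruence (subst (m Signed.∣_) (lemma a b c) (Signed.∣m∣n⇒∣m+n m∣a-b m∣b-c))
    where
    lemma : ∀ a b c → (a - b) + (b - c) ≡ a - c
    lemma = solve-∀

  mod-+ : ∀ {a b c d} → a ≡ b [mod m ] → c ≡ d [mod m ] → a + c ≡ b + d [mod m ]
  mod-+ {a} {b} {c} {d} (congruence m∣a-b) (congruence m∣c-d) =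
    congruence (subst (m Signed.∣_) (lemma a b c d) (Signed.∣m∣n⇒∣m+n m∣a-b m∣c-d))
    where
    lemma : ∀ a b c d → (a - b) + (c - d) ≡ (a + c) - (b + d)
    lemma = solve-∀

  mod-neg : ∀ {a b} → a ≡ b [mod m ] → - a ≡ - b [mod m ]
  mod-neg {a} {b} (congruence m∣a-b) = congruence (subst (m Signed.∣_) (lemma a b) (Signed.∣m⇒∣-m m∣a-b))
    where
    lemma : ∀ a b → - (a - b) ≡ - a - - b
    lemma = solve-∀

  mod-* : ∀ {a b c d} → a ≡ b [mod m ] → c ≡ d [mod m ] → a * c ≡ b * d [mod m ]
  mod-* {a} {b} {c} {d} (congruence m∣a-b) (congruence m∣c-d) = congruence
    (subst (m Signed.∣_) (lemma a b c d) (Signed.∣m∣n⇒∣m+n (Signed.∣m⇒∣m*n c m∣a-b) (Signed.∣n⇒∣m*n b m∣c-d)))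
    where
    lemma : ∀ a b c d → (a - b) * c + b * (c - d) ≡ a * c - b * d
    lemma = solve-∀

  mod-+ˡ : ∀ c {a b} → a ≡ b [mod m ] → c + a ≡ c + b [mod m ]
  mod-+ˡ c = mod-+ (mod-reflexive {a = c} refl)

  mod-+ʳ : ∀ c {a b} → a ≡ b [mod m ] → a + c ≡ b + c [mod m ]
  mod-+ʳ c a≡b = mod-+ a≡b (mod-reflexive {a = c} refl)

  mod-*ˡ : ∀ c {a b} → a ≡ b [mod m ] → c * a ≡ c * b [mod m ]
  mod-*ˡ c = mod-* (mod-reflexive {a = c} refl)

  mod-*ʳ : ∀ c {a b} → a ≡ b [mod m ] → a * c ≡ b * c [mod m ]
  mod-*ʳ c a≡b = mod-* a≡b (mod-reflexive {a = c} refl)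

mod-setoid : ℤ → Setoid _ _
mod-setoid m = record
  { Carrier = ℤ
  ; _≈_ = _≡_[mod m ]
  ; isEquivalence = record { refl = mod-reflexive refl ; sym = mod-sym ; trans = mod-trans }
  }

sum-cong-mod : ∀ {m} n {f g} → (∀ {j} → 1 ≤ j → j ≤ n → f j ≡ g j [mod m ]) → sum n f ≡ sum n g [mod m ]
sum-cong-mod zero    f≡g = mod-reflexive refl
sum-cong-mod (suc n) f≡g =
  mod-+ (sum-cong-mod n (λ 1≤j j≤n → f≡g 1≤j (ℕ.m≤n⇒m≤1+n j≤n))) (f≡g (s≤s z≤n) ℕ.≤-refl)

sum-reflect-mod : ∀ {m} n {f g} → (∀ {i j} → 1 ≤ i → 1 ≤ j → i ℕ.+ j ≡ suc n → f i ≡ g j [mod m ]) →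
                  sum n f ≡ sum n g [mod m ]
sum-reflect-mod n {f} {g} reflect = mod-trans (mod-reflexive (sum-reverse n f))
  (sum-cong-mod n (λ {j} 1≤j j≤n → reflect (ℕ.m<n⇒0<n∸m (s≤s j≤n)) 1≤j (ℕ.m∸n+n≡m (ℕ.m≤n⇒m≤1+n j≤n))))

inverse-unique : ∀ {m a b y z} → a ≡ b [mod m ] → a * y ≡ + 1 [mod m ] → b * z ≡ + 1 [mod m ] →
                 y ≡ z [mod m ]
inverse-unique {m} {a} {b} {y} {z} a≡b ay≡1 bz≡1 = begin
  y             ≡⟨ *-identityʳ y ⟨
  y * + 1       ≈⟨ mod-*ˡ y bz≡1 ⟨
  y * (b * z)   ≈⟨ mod-*ˡ y (mod-*ʳ z a≡b) ⟨
  y * (a * z)   ≡⟨ lemma y a z ⟩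
  (a * y) * z   ≈⟨ mod-*ʳ z ay≡1 ⟩
  + 1 * z       ≡⟨ *-identityˡ z ⟩
  z             ∎
  where
  open SetoidReasoning (mod-setoid m)
  lemma : ∀ y a z → y * (a * z) ≡ (a * y) * z
  lemma = solve-∀

pos-∸ : ∀ {m n} → n ≤ m → + (m ∸ n) ≡ + m - + n
pos-∸ {m} {n} n≤m = sym (trans (m-n≡m⊖n m n) (⊖-≥ n≤m))

eₙ₋₁ : ℕ → (ℕ → ℤ) → ℤ
eₙ₋₁ zero    x = + 0
eₙ₋₁ (suc n) x = eₙ₋₁ n x * x (suc n) + prod n x

prod-+-expansion : ∀ n c x → ∃[ r ] prod n (λ j → c + x j) ≡ prod n x + c * eₙ₋₁ n x + c * c * r
prod-+-expansion zero    c x = + 0 , lemma c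
  where
  lemma : ∀ c → + 1 ≡ + 1 + c * + 0 + c * c * + 0
  lemma = solve-∀
prod-+-expansion (suc n) c x with prod-+-expansion n c x
... | r , eq rewrite eq = r * (c + x (suc n)) + eₙ₋₁ n x , lemma (prod n x) (eₙ₋₁ n x) r c (x (suc n))
  where
  lemma : ∀ a e r c y → (a + c * e + c * c * r) * (c + y) ≡ a * y + c * (e * y + a) + c * c * (r * (c + y) + e)
  lemma = solve-∀

eₙ₋₁-inverses : ∀ {m} n x u → (∀ {j} → 1 ≤ j → j ≤ n → x j * u j ≡ + 1 [mod m ]) →
                eₙ₋₁ n x ≡ prod n x * sum n u [mod m ]
eₙ₋₁-inverses zero    x u xu≡1 = mod-reflexive refl
eₙ₋₁-inverses {m} (suc n) x u xu≡1 = begin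
  eₙ₋₁ n x * y + a              ≈⟨ mod-+ʳ a (mod-*ʳ y (eₙ₋₁-inverses n x u (λ 1≤j j≤n → xu≡1 1≤j (ℕ.m≤n⇒m≤1+n j≤n)))) ⟩
  a * s * y + a                 ≡⟨ cong (λ t → a * s * y + t) (*-identityʳ a) ⟨
  a * s * y + a * + 1           ≈⟨ mod-+ˡ (a * s * y) (mod-*ˡ a (xu≡1 (s≤s z≤n) ℕ.≤-refl)) ⟨
  a * s * y + a * (y * v)       ≡⟨ lemma a s y v ⟩
  a * y * (s + v)               ∎
  where
  open SetoidReasoning (mod-setoid m)
  a = prod n x
  s = sum n u
  y = x (suc n)
  v = u (suc n)
  lemma : ∀ a s y v → a * s * y + a * (y * v) ≡ a * y * (s + v)
  lemma = solve-∀

m³∣[a+ce+c²r]-a : ∀ {m} a e r → e ≡ + 0 [mod m ] → let c = (+ 2 * m) * (+ 2 * m) in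
                  m ^ 3 ∣ a + c * e + c * c * r - a
m³∣[a+ce+c²r]-a {m} a e r (congruence (divides t e-0≡tm)) =
  Signed.∣⇒∣ᵤ (divides (+ 4 * t + + 16 * m * r) (begin
    a + c * e + c * c * r - a              ≡⟨ cong (λ e → a + c * e + c * c * r - a) e≡tm ⟩
    a + c * (t * m) + c * c * r - a        ≡⟨ lemma a t r m ⟩
    (+ 4 * t + + 16 * m * r) * m ^ 3       ∎))
  where
  open ≡-Reasoning
  c = (+ 2 * m) * (+ 2 * m)
  e≡tm : e ≡ t * m
  e≡tm = trans (sym (+-identityʳ e)) e-0≡tm
  lemma : ∀ a t r m → let c = (+ 2 * m) * (+ 2 * m) in
          a + c * (t * m) + c * c * r - a ≡ (+ 4 * t + + 16 * m * r) * (m * (m * (m * + 1)))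
  lemma = solve-∀

-- Junk value: inverse m a = 0 when m and a are not coprime.
inverse : ℕ → ℕ → ℤ
inverse m a with coprime? m a
... | no _ = + 0
... | yes m⊥a with coprime-Bézout m⊥a
...   | Bézout.+- _ y _ = - + y
...   | Bézout.-+ _ y _ = + y

*-inverse : ∀ {m a} → Coprime m a → + a * inverse m a ≡ + 1 [mod + m ]
*-inverse {m} {a} m⊥a with coprime? m a
... | no ¬m⊥a = contradiction (λ {d} → m⊥a {d}) ¬m⊥a
... | yes m⊥a′ with coprime-Bézout m⊥a′
...   | Bézout.+- x y eq = congruence (divides (- + x) (begin
  + a * - + y - + 1             ≡⟨ lemma (+ a) (+ y) ⟩
  - (+ 1 + + y * + a)           ≡⟨ cong (λ t → - (+ 1 + t)) (pos-* y a) ⟨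
  - + (1 ℕ.+ y ℕ.* a)           ≡⟨ cong (λ t → - + t) eq ⟩
  - + (x ℕ.* m)                 ≡⟨ cong -_ (pos-* x m) ⟩
  - (+ x * + m)                 ≡⟨ neg-distribˡ-* (+ x) (+ m) ⟩
  - + x * + m                   ∎))
  where
  open ≡-Reasoning
  lemma : ∀ a y → a * - y - + 1 ≡ - (+ 1 + y * a)
  lemma = solve-∀
...   | Bézout.-+ x y eq = congruence (divides (+ x) (begin
  + a * + y - + 1               ≡⟨ cong (_- + 1) (*-comm (+ a) (+ y)) ⟩
  + y * + a - + 1               ≡⟨ cong (_- + 1) (pos-* y a) ⟨
  + (y ℕ.* a) - + 1             ≡⟨ cong (λ t → + t - + 1) eq ⟨
  + (1 ℕ.+ x ℕ.* m) - + 1       ≡⟨ cong (λ t → + 1 + t - + 1) (pos-* x m) ⟩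
  + 1 + + x * + m - + 1         ≡⟨ lemma (+ x * + m) ⟩
  + x * + m                     ∎))
  where
  open ≡-Reasoning
  lemma : ∀ t → + 1 + t - + 1 ≡ t
  lemma = solve-∀

prime-cancel : ∀ {p a x} → Prime p → 0 < a → a < p → + a * x ≡ + 0 [mod + p ] → x ≡ + 0 [mod + p ]
prime-cancel {p} {a} {x} p-prime 0<a a<p (congruence p∣ax-0) =
  congruence (Signed.∣ᵤ⇒∣ (subst (+ p ∣_) (sym (+-identityʳ x)) (coprime-divisor (+ p) (+ a) x p⊥a p∣ax)))
  where
  p⊥a : Coprime p a
  p⊥a = prime⇒coprime p-prime {{ℕ.>-nonZero 0<a}} a<p
  p∣ax : + p ∣ + a * x
  p∣ax = Signed.∣⇒∣ᵤ (subst (+ p Signed.∣_) (+-identityʳ (+ a * x)) p∣ax-0)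

module InverseSquares {p : ℕ} (p-prime : Prime p) where

  inv² : ℕ → ℤ
  inv² k = inverse p k * inverse p k

  inv²-inverse : ∀ {k} → 0 < k → k < p → (+ k * + k) * inv² k ≡ + 1 [mod + p ]
  inv²-inverse {k} 0<k k<p = begin
    (+ k * + k) * (y * y)   ≡⟨ lemma (+ k) y ⟩
    (+ k * y) * (+ k * y)   ≈⟨ mod-* ky≡1 ky≡1 ⟩
    + 1                     ∎
    where
    open SetoidReasoning (mod-setoid (+ p))
    y = inverse p k
    ky≡1 : + k * y ≡ + 1 [mod + p ]
    ky≡1 = *-inverse (prime⇒coprime p-prime {{ℕ.>-nonZero 0<k}} k<p)
    lemma : ∀ k y → (k * k) * (y * y) ≡ (k * y) * (k * y)
    lemma = solve-∀

  inv²-reflect : ∀ {a b} → 0 < a → 0 < b → a ℕ.+ b ≡ p → inv² a ≡ inv² b [mod + p ]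
  inv²-reflect {a} {b} 0<a 0<b a+b≡p = inverse-unique a²≡b² (inv²-inverse 0<a a<p) (inv²-inverse 0<b b<p)
    where
    a<p : a < p
    a<p = subst (a <_) a+b≡p (ℕ.m<m+n a 0<b)
    b<p : b < p
    b<p = subst (b <_) (trans (ℕ.+-comm b a) a+b≡p) (ℕ.m<m+n b 0<a)
    lemma : ∀ a b → a * a - b * b ≡ (a - b) * (a + b)
    lemma = solve-∀
    a²≡b² : + a * + a ≡ + b * + b [mod + p ]
    a²≡b² = congruence (divides (+ a - + b) (trans (lemma (+ a) (+ b)) (cong (λ t → (+ a - + b) * + t) a+b≡p)))

  inv²-double : ∀ {k} → 0 < k → 2 ℕ.* k < p → + 4 * inv² (2 ℕ.* k) ≡ inv² k [mod + p ]
  inv²-double {k} 0<k 2k<p =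
    inverse-unique (mod-reflexive {a = + k * + k} refl) k²·4inv²[2k]≡1 (inv²-inverse 0<k k<p)
    where
    open SetoidReasoning (mod-setoid (+ p))
    k<p : k < p
    k<p = ℕ.≤-<-trans (ℕ.m≤m+n k (k ℕ.+ 0)) 2k<p
    lemma : ∀ k y → (k * k) * (+ 4 * y) ≡ ((+ 2 * k) * (+ 2 * k)) * y
    lemma = solve-∀
    k²·4inv²[2k]≡1 : (+ k * + k) * (+ 4 * inv² (2 ℕ.* k)) ≡ + 1 [mod + p ]
    k²·4inv²[2k]≡1 = begin
      (+ k * + k) * (+ 4 * inv² (2 ℕ.* k))                   ≡⟨ lemma (+ k) (inv² (2 ℕ.* k)) ⟩
      ((+ 2 * + k) * (+ 2 * + k)) * inv² (2 ℕ.* k)           ≡⟨ cong (λ t → (t * t) * inv² (2 ℕ.* k)) (pos-* 2 k) ⟨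
      (+ (2 ℕ.* k) * + (2 ℕ.* k)) * inv² (2 ℕ.* k)           ≈⟨ inv²-inverse (ℕ.≤-trans 0<k (ℕ.m≤m+n k (k ℕ.+ 0))) 2k<p ⟩
      + 1                                                    ∎

even-or-odd : ∀ m → (∃[ n ] m ≡ 2 ℕ.* n) ⊎ (∃[ n ] m ≡ suc (2 ℕ.* n))
even-or-odd zero    = inj₁ (0 , refl)
even-or-odd (suc m) with even-or-odd m
... | inj₁ (n , refl) = inj₂ (n , refl)
... | inj₂ (n , refl) = inj₁ (suc n , cong suc (sym (ℕ.+-suc n (n ℕ.+ 0))))

odd-prime : ∀ {p} → Prime p → 2 < p → ∃[ n ] p ≡ suc (2 ℕ.* n)
odd-prime {p} p-prime 2<p with even-or-odd p
... | inj₂ odd        = odd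
... | inj₁ (n , refl) = contradiction p-prime
  (composite⇒¬prime (composite-≢ 2 {{_}} {{prime⇒nonZero p-prime}} (ℕ.<⇒≢ 2<p) (ℕ.divides n (ℕ.*-comm 2 n))))

module OddPrime (n : ℕ) (p-prime : Prime (suc (2 ℕ.* n))) (3<p : 3 < suc (2 ℕ.* n)) where

  p : ℕ
  p = suc (2 ℕ.* n)

  open InverseSquares p-prime

  half evens odds full : ℤ
  half  = sum n inv²
  evens = sum n (λ j → inv² (2 ℕ.* j))
  odds  = sum n (λ j → inv² (2 ℕ.* j ∸ 1))
  full  = sum (2 ℕ.* n) inv²

  full≡odds+evens : full ≡ odds + evens
  full≡odds+evens = trans (sum-pairs n inv²) (sum-+ n (λ j → inv² (2 ℕ.* j ∸ 1)) (λ j → inv² (2 ℕ.* j)))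

  full≡half+half : full ≡ half + half [mod + p ]
  full≡half+half = begin
    full                                 ≡⟨ cong (λ t → sum (n ℕ.+ t) inv²) (ℕ.+-identityʳ n) ⟩
    sum (n ℕ.+ n) inv²                   ≡⟨ sum-split n n inv² ⟩
    half + sum n (λ j → inv² (n ℕ.+ j))  ≈⟨ mod-+ˡ half (sum-reflect-mod n reflect) ⟩
    half + half                          ∎
    where
    open SetoidReasoning (mod-setoid (+ p))
    lemma : ∀ n → n ℕ.+ suc n ≡ suc (2 ℕ.* n)
    lemma = NS.solve-∀
    reflect : ∀ {i j} → 1 ≤ i → 1 ≤ j → i ℕ.+ j ≡ suc n → inv² (n ℕ.+ i) ≡ inv² j [mod + p ]
    reflect {i} {j} 1≤i 1≤j i+j≡1+n = inv²-reflect (ℕ.≤-trans 1≤i (ℕ.m≤n+m i n)) 1≤j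
      (trans (ℕ.+-assoc n i j) (trans (cong (n ℕ.+_) i+j≡1+n) (lemma n)))

  odds≡evens : odds ≡ evens [mod + p ]
  odds≡evens = sum-reflect-mod n reflect
    where
    lemma : ∀ i j → i ℕ.+ suc (i ℕ.+ 0) ℕ.+ 2 ℕ.* j ≡ suc (2 ℕ.* (i ℕ.+ j))
    lemma = NS.solve-∀
    reflect : ∀ {i j} → 1 ≤ i → 1 ≤ j → i ℕ.+ j ≡ suc n → inv² (2 ℕ.* i ∸ 1) ≡ inv² (2 ℕ.* j) [mod + p ]
    reflect {suc i} {j} _ 1≤j 1+i+j≡1+n = inv²-reflect (ℕ.≤-trans (s≤s z≤n) (ℕ.m≤n+m (suc (i ℕ.+ 0)) i))
      (ℕ.≤-trans 1≤j (ℕ.m≤m+n j (j ℕ.+ 0)))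
      (trans (lemma i j) (cong (λ t → suc (2 ℕ.* t)) (ℕ.suc-injective 1+i+j≡1+n)))

  4·evens≡half : + 4 * evens ≡ half [mod + p ]
  4·evens≡half = mod-trans (mod-reflexive (*-distribˡ-sum n (+ 4) (λ j → inv² (2 ℕ.* j))))
    (sum-cong-mod n (λ 1≤j j≤n → inv²-double 1≤j (s≤s (ℕ.*-monoʳ-≤ 2 j≤n))))

  6·evens≡0 : + 2 * (+ 3 * evens) ≡ + 0 [mod + p ]
  6·evens≡0 = begin
    + 2 * (+ 3 * evens)                             ≡⟨ lemma evens ⟩
    (+ 4 * evens + + 4 * evens) - (evens + evens)   ≈⟨ mod-+ (mod-+ 4·evens≡half 4·evens≡half)
                                                             (mod-neg (mod-+ʳ evens (mod-sym odds≡evens))) ⟩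
    (half + half) - (odds + evens)                  ≈⟨ mod-+ (mod-sym full≡half+half)
                                                             (mod-neg (mod-reflexive (sym full≡odds+evens))) ⟩
    full - full                                     ≡⟨ +-inverseʳ full ⟩
    + 0                                             ∎
    where
    open SetoidReasoning (mod-setoid (+ p))
    lemma : ∀ e → + 2 * (+ 3 * e) ≡ (+ 4 * e + + 4 * e) - (e + e)
    lemma = solve-∀

  odds≡0 : odds ≡ + 0 [mod + p ]
  odds≡0 = mod-trans odds≡evens (prime-cancel {a = 3} p-prime (s≤s z≤n) 3<p
                                  (prime-cancel {a = 2} p-prime (s≤s z≤n) (ℕ.<-trans (ℕ.n<1+n 2) 3<p) 6·evens≡0))

  F g : ℕ → ℤ
  F k = + p + + 2 * + k
  g k = (+ 2 * + k - + 1) ^ 2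

  c : ℤ
  c = (+ 2 * + p) * (+ 2 * + p)

  prod-F : prod (2 ℕ.* n) F ≡ prod n (λ j → c + - g j)
  prod-F = trans (prod-halves n F) (prod-cong n pair)
    where
    -- Instantiated at + n, the p below is + p by conversion, so p need not be rewritten.
    lemma : ∀ n j → let p = + 1 + (n + (n + + 0)) ; 2j-1 = + 2 * j - + 1 in
            (p + + 2 * (+ 1 + n - j)) * (p + + 2 * (n + j)) ≡ (+ 2 * p) * (+ 2 * p) + - (2j-1 * (2j-1 * + 1))
    lemma = solve-∀
    pair : ∀ {j} → 1 ≤ j → j ≤ n → F (suc n ∸ j) * F (n ℕ.+ j) ≡ c + - g j
    pair {j} _ j≤n =
      trans (cong (λ t → (+ p + + 2 * t) * F (n ℕ.+ j)) (pos-∸ (ℕ.m≤n⇒m≤1+n j≤n))) (lemma (+ n) (+ j))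

  eₙ₋₁≡0 : eₙ₋₁ n (λ j → - g j) ≡ + 0 [mod + p ]
  eₙ₋₁≡0 = begin
    eₙ₋₁ n x                                   ≈⟨ eₙ₋₁-inverses n x u xu≡1 ⟩
    prod n x * sum n u                         ≡⟨ cong (prod n x *_) (*-distribˡ-sum n (- + 1) (λ j → inv² (2 ℕ.* j ∸ 1))) ⟨
    prod n x * (- + 1 * odds)                  ≈⟨ mod-*ˡ (prod n x) (mod-*ˡ (- + 1) odds≡0) ⟩
    prod n x * (- + 1 * + 0)                   ≡⟨ *-zeroʳ (prod n x) ⟩
    + 0                                        ∎
    where
    open SetoidReasoning (mod-setoid (+ p))
    x u : ℕ → ℤ
    x j = - g j
    u j = - + 1 * inv² (2 ℕ.* j ∸ 1)
    lemma : ∀ t y → - (t * (t * + 1)) * (- + 1 * y) ≡ (t * t) * y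
    lemma = solve-∀
    xu≡1 : ∀ {j} → 1 ≤ j → j ≤ n → x j * u j ≡ + 1 [mod + p ]
    xu≡1 {j} 1≤j j≤n = begin
      x j * u j                                         ≡⟨ lemma (+ 2 * + j - + 1) (inv² k) ⟩
      ((+ 2 * + j - + 1) * (+ 2 * + j - + 1)) * inv² k  ≡⟨ cong (λ t → (t * t) * inv² k) k≡2j-1 ⟨
      (+ k * + k) * inv² k                              ≈⟨ inv²-inverse 0<k k<p ⟩
      + 1                                               ∎
      where
      k = 2 ℕ.* j ∸ 1
      2j≤2n : 2 ℕ.* j ≤ 2 ℕ.* n
      2j≤2n = ℕ.*-monoʳ-≤ 2 j≤n
      1≤2j : 1 ≤ 2 ℕ.* j
      1≤2j = ℕ.≤-trans 1≤j (ℕ.m≤m+n j (j ℕ.+ 0))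
      k≡2j-1 : + k ≡ + 2 * + j - + 1
      k≡2j-1 = trans (pos-∸ 1≤2j) (cong (_- + 1) (pos-* 2 j))
      0<k : 0 < k
      0<k = ℕ.m<n⇒0<n∸m (ℕ.*-monoʳ-≤ 2 1≤j)
      k<p : k < p
      k<p = s≤s (ℕ.≤-trans (ℕ.m∸n≤m (2 ℕ.* j) 1) 2j≤2n)

  p³∣difference : (+ p) ^ 3 ∣ (prod (2 ℕ.* n) F - (- + 1) ^ n * prod n g)
  p³∣difference with prod-+-expansion n c (λ j → - g j)
  ... | r , expansion = subst ((+ p) ^ 3 ∣_) (sym difference) (m³∣[a+ce+c²r]-a a e r eₙ₋₁≡0)
    where
    a e : ℤ
    a = prod n (λ j → - g j)
    e = eₙ₋₁ n (λ j → - g j)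
    difference : prod (2 ℕ.* n) F - (- + 1) ^ n * prod n g ≡ a + c * e + c * c * r - a
    difference = cong₂ _-_ (trans prod-F expansion) (prod-neg n g)

lemma2p1 : (p : ℕ) → Prime p → p > 3 →
    (+ p) ^ 3 ∣ (prod (p ∸ 1) (λ k → + p + + 2 * + k)
                 - (- + 1) ^ ((p ∸ 1) / 2) * prod ((p ∸ 1) / 2) (λ k → (+ 2 * + k - + 1) ^ 2))
lemma2p1 p p-prime 3<p with odd-prime p-prime (ℕ.<-trans (ℕ.n<1+n 2) 3<p)
... | n , refl rewrite trans (cong (_/ 2) (ℕ.*-comm 2 n)) (m*n/n≡m n 2) =
  OddPrime.p³∣difference n p-prime 3<p
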